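{- Let $n \geq 2$ be an integer. If $\varphi$ is an edge precoloring of two edges of $C_{2n} \square K_2$ using colors from $\{1,2,3\}$, then $\varphi$ can be extended to a proper $3$-edge coloring of $C_{2n} \square K_2$.
   Context: $C_m$ is the cycle on $m$ vertices and $G \square H$ the cartesian product. An edge precoloring is a proper edge coloring of some subset of the edges; it is extended by a proper $t$-edge coloring $f$ (colors $\{1,\dots,t\}$) if $f$ agrees with it on all precolored edges. -}

module Defs where

open import Data.Nat using (ℕ; zero; suc; _*_)
open import Data.Fin using (Fin; toℕ)
open import Data.Product using (_×_; _,_)
open import Data.Sum using (_⊎_)
open import Relation.Binary.PropositionalEquality using (_≡_; _≢_)
open import Relation.Nullary using (¬_)

Vtx : ℕ → Set
Vtx m = Fin m × Fin 2

CSucc : (m : ℕ) → Fin m → Fin m → Set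
CSucc m i j = (suc (toℕ i) ≡ toℕ j) ⊎ (suc (toℕ i) ≡ m × toℕ j ≡ 0)

CAdj : (m : ℕ) → Fin m → Fin m → Set
CAdj m i j = CSucc m i j ⊎ CSucc m j i

KAdj : Fin 2 → Fin 2 → Set
KAdj s t = s ≢ t

Adj : (m : ℕ) → Vtx m → Vtx m → Set
Adj m (i , s) (j , t) = (CAdj m i j × s ≡ t) ⊎ (i ≡ j × KAdj s t)

SameEdge : {A : Set} → A → A → A → A → Set
SameEdge u v u' v' = (u ≡ u' × v ≡ v') ⊎ (u ≡ v' × v ≡ u')

-- A t-edge coloring of C_m □ K_2: assigns a color in Fin t (colors 1..t
-- shifted to 0..t-1) to every ordered adjacent pair, independent of the
-- orientation of the edge.
record EdgeColoring (m t : ℕ) : Set where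
  field
    col     : (u v : Vtx m) → Adj m u v → Fin t
    undirected : ∀ u v (a : Adj m u v) (b : Adj m v u) → col u v a ≡ col v u b
    irrelevant : ∀ u v (a b : Adj m u v) → col u v a ≡ col u v b
open EdgeColoring public

Proper : {m t : ℕ} → EdgeColoring m t → Set
Proper {m} f = ∀ u v w (a : Adj m u v) (b : Adj m u w) → v ≢ w →
  col f u v a ≢ col f u w b

record TwoEdgePrecoloring (m : ℕ) : Set where
  field
    a₁ b₁ a₂ b₂ : Vtx m
    e₁ : Adj m a₁ b₁
    e₂ : Adj m a₂ b₂
    distinct : ¬ SameEdge a₁ b₁ a₂ b₂
    c₁ c₂ : Fin 3
    proper : (a₁ ≡ a₂ ⊎ a₁ ≡ b₂ ⊎ b₁ ≡ a₂ ⊎ b₁ ≡ b₂) → c₁ ≢ c₂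

Extends : {m : ℕ} → EdgeColoring m 3 → TwoEdgePrecoloring m → Set
Extends f φ = col f a₁ b₁ e₁ ≡ c₁ × col f a₂ b₂ e₂ ≡ c₂
  where open TwoEdgePrecoloring φ

{-# OPTIONS --safe #-}
-- Since the cycle is even, we may color all rungs a and each of the two rims
-- alternately x, y, with an independent phase on each rim.  In such a coloring
-- the 4-cycle through two consecutive rungs uses only two colors, so swapping
-- them (a Kempe change) keeps the coloring proper.  Every pair of compatibly
-- precolored edges is realised by a suitable choice of a, x, y and the phases,
-- followed by at most two swaps on disjoint squares.
module Submission where

open import Defs
open import Data.Nat using (ℕ; zero; suc; _≤_; _*_; s≤s; parity)
open import Data.Nat.Properties
  using (_<?_; suc-injective; ≤-antisym; ≮⇒≥; <-irrefl; ≤-trans; n≤1+n; *-monoʳ-≤; 1+n≢0; m≢1+n+m)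
open import Data.Fin using (Fin; zero; suc; toℕ; fromℕ; fromℕ<; inject₁)
open import Data.Fin.Properties using (_≟_; toℕ-injective; toℕ<n; toℕ-fromℕ; toℕ-fromℕ<; toℕ-inject₁)
open import Data.Parity.Base using (Parity; 0ℙ; 1ℙ; _⁻¹; _+_)
open import Data.Parity.Properties using (p+p≡0ℙ; p⁻¹+p≡1ℙ; p≢p⁻¹; ⁻¹-selfInverse; suc-homo-⁻¹; *-homo-*)
open import Data.Vec.Functional using (updateAt)
open import Data.Vec.Functional.Properties using (updateAt-updates; updateAt-minimal)
open import Data.Product using (Σ; _×_; _,_; proj₁; proj₂)
open import Data.Sum using (_⊎_; inj₁; inj₂)
open import Data.Empty using (⊥; ⊥-elim)
open import Function using (_∘_; const)
open import Relation.Nullary using (yes; no)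
open import Relation.Binary.PropositionalEquality using (_≡_; _≢_; refl; sym; trans; cong; subst; ≢-sym)

Color : Set
Color = Fin 3

Distinct₃ : Color → Color → Color → Set
Distinct₃ a b c = a ≢ b × a ≢ c × b ≢ c

Distinct₃-rotate : ∀ {a b c} → Distinct₃ a b c → Distinct₃ c a b
Distinct₃-rotate (a≢b , a≢c , b≢c) = ≢-sym a≢c , ≢-sym b≢c , a≢b

Distinct₃-resp : ∀ {a b c a′ b′ c′} → a ≡ a′ → b ≡ b′ → c ≡ c′ →
  Distinct₃ a′ b′ c′ → Distinct₃ a b c
Distinct₃-resp refl refl refl d = d

third : Color → Color → Color
third zero             (suc zero)       = suc (suc zero)
third (suc zero)       zero             = suc (suc zero)
third zero             (suc (suc zero)) = suc zero
third (suc (suc zero)) zero             = suc zero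
third _                _                = zero

third-distinct : ∀ x y → x ≢ y → Distinct₃ x y (third x y)
third-distinct zero             zero             x≢y = ⊥-elim (x≢y refl)
third-distinct zero             (suc zero)       x≢y = x≢y , (λ ()) , (λ ())
third-distinct zero             (suc (suc zero)) x≢y = x≢y , (λ ()) , (λ ())
third-distinct (suc zero)       zero             x≢y = x≢y , (λ ()) , (λ ())
third-distinct (suc zero)       (suc zero)       x≢y = ⊥-elim (x≢y refl)
third-distinct (suc zero)       (suc (suc zero)) x≢y = x≢y , (λ ()) , (λ ())
third-distinct (suc (suc zero)) zero             x≢y = x≢y , (λ ()) , (λ ())
third-distinct (suc (suc zero)) (suc zero)       x≢y = x≢y , (λ ()) , (λ ())
third-distinct (suc (suc zero)) (suc (suc zero)) x≢y = ⊥-elim (x≢y refl)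

next : Color → Color
next zero             = suc zero
next (suc zero)       = suc (suc zero)
next (suc (suc zero)) = zero

next-≢ : ∀ c → c ≢ next c
next-≢ zero             ()
next-≢ (suc zero)       ()
next-≢ (suc (suc zero)) ()

next-third-distinct : ∀ c → Distinct₃ c (next c) (third c (next c))
next-third-distinct c = third-distinct c (next c) (next-≢ c)

alternate : Parity → Color → Color → Color
alternate 0ℙ x y = x
alternate 1ℙ x y = y

alternate-≢ : ∀ {a x y} → x ≢ a → y ≢ a → ∀ p → alternate p x y ≢ a
alternate-≢ x≢a y≢a 0ℙ = x≢a
alternate-≢ x≢a y≢a 1ℙ = y≢a

alternate-⁻¹ : ∀ {x y} → x ≢ y → ∀ p → alternate (p ⁻¹) x y ≢ alternate p x y
alternate-⁻¹ x≢y 0ℙ = ≢-sym x≢y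
alternate-⁻¹ x≢y 1ℙ = x≢y

alternate-p+p : ∀ p x y → alternate (p + p) x y ≡ x
alternate-p+p p x y = cong (λ q → alternate q x y) (p+p≡0ℙ p)

alternate-p⁻¹+p : ∀ p x y → alternate (p ⁻¹ + p) x y ≡ y
alternate-p⁻¹+p p x y = cong (λ q → alternate q x y) (p⁻¹+p≡1ℙ p)

p+q⁻¹≡[p+q]⁻¹ : ∀ p q → p + q ⁻¹ ≡ (p + q) ⁻¹
p+q⁻¹≡[p+q]⁻¹ 0ℙ q = refl
p+q⁻¹≡[p+q]⁻¹ 1ℙ q = refl

≢-unique : ∀ {s t u : Fin 2} → s ≢ t → s ≢ u → t ≡ u
≢-unique {zero}     {zero}                 s≢t _   = ⊥-elim (s≢t refl)
≢-unique {zero}     {suc zero} {zero}      _   s≢u = ⊥-elim (s≢u refl)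
≢-unique {zero}     {suc zero} {suc zero}  _   _   = refl
≢-unique {suc zero} {zero}     {zero}      _   _   = refl
≢-unique {suc zero} {zero}     {suc zero}  _   s≢u = ⊥-elim (s≢u refl)
≢-unique {suc zero} {suc zero}             s≢t _   = ⊥-elim (s≢t refl)

shared-endpoint : {A : Set} {v a₁ b₁ a₂ b₂ : A} → v ≡ a₁ ⊎ v ≡ b₁ → v ≡ a₂ ⊎ v ≡ b₂ →
  a₁ ≡ a₂ ⊎ a₁ ≡ b₂ ⊎ b₁ ≡ a₂ ⊎ b₁ ≡ b₂
shared-endpoint (inj₁ p) (inj₁ q) = inj₁ (trans (sym p) q)
shared-endpoint (inj₁ p) (inj₂ q) = inj₂ (inj₁ (trans (sym p) q))
shared-endpoint (inj₂ p) (inj₁ q) = inj₂ (inj₂ (inj₁ (trans (sym p) q)))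
shared-endpoint (inj₂ p) (inj₂ q) = inj₂ (inj₂ (inj₂ (trans (sym p) q)))

record EvenCycle (m : ℕ) : Set where
  field
    succ           : Fin m → Fin m
    pred           : Fin m → Fin m
    succ-pred      : ∀ i → succ (pred i) ≡ i
    succ-injective : ∀ {i j} → succ i ≡ succ j → i ≡ j
    succ²≢id       : ∀ i → succ (succ i) ≢ i
    side           : Fin m → Parity
    side-succ      : ∀ i → side (succ i) ≡ side i ⁻¹
    CSucc⇒succ     : ∀ {i j} → CSucc m i j → succ i ≡ j

  succ≢id : ∀ i → succ i ≢ i
  succ≢id i e = p≢p⁻¹ (side i) (trans (cong side (sym e)) (side-succ i))

module Prism {m : ℕ} (C : EvenCycle m) where
  open EvenCycle C

  -- rimColor κ s k is the color of the cycle edge from (k , s) to (succ k , s).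
  record PrismColoring : Set where
    constructor coloring
    field
      rungColor : Fin m → Color
      rimColor  : Fin 2 → Fin m → Color
  open PrismColoring

  -- The three edges at the vertex (succ j , s); every vertex has this form.
  LocallyProper : PrismColoring → Set
  LocallyProper κ = ∀ s j → Distinct₃ (rungColor κ (succ j)) (rimColor κ s (succ j)) (rimColor κ s j)

  module _ {κ : PrismColoring} (lp : LocallyProper κ) where

    rung≢rim-forward : ∀ s i → rungColor κ i ≢ rimColor κ s i
    rung≢rim-forward s i =
      subst (λ i → rungColor κ i ≢ rimColor κ s i) (succ-pred i) (proj₁ (lp s (pred i)))

    rung≢rim-backward : ∀ s {i j} → succ j ≡ i → rungColor κ i ≢ rimColor κ s j
    rung≢rim-backward s {j = j} refl = proj₁ (proj₂ (lp s j))

    rim-forward≢backward : ∀ s {i j} → succ j ≡ i → rimColor κ s i ≢ rimColor κ s j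
    rim-forward≢backward s {j = j} refl = proj₂ (proj₂ (lp s j))

  alternating : Color → Color → Color → (Fin 2 → Parity) → PrismColoring
  alternating a x y phase = coloring (const a) (λ s k → alternate (phase s + side k) x y)

  alternating-proper : ∀ {a x y} → Distinct₃ a x y → ∀ phase → LocallyProper (alternating a x y phase)
  alternating-proper {a} {x} {y} (a≢x , a≢y , x≢y) phase s j
    rewrite side-succ j | p+q⁻¹≡[p+q]⁻¹ (phase s) (side j) =
    avoids-a _ , avoids-a _ , alternate-⁻¹ x≢y (phase s + side j)
    where
    avoids-a : ∀ p → a ≢ alternate p x y
    avoids-a p = ≢-sym (alternate-≢ (≢-sym a≢x) (≢-sym a≢y) p)

  alternating-rim : ∀ a x y phase s k {p} → phase s ≡ p →
    rimColor (alternating a x y phase) s k ≡ alternate (p + side k) x y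
  alternating-rim a x y phase s k e = cong (λ q → alternate (q + side k) x y) e

  uniform : Color → Color → Color → Parity → PrismColoring
  uniform a x y q = alternating a x y (const q)

  Bicolored : Fin m → PrismColoring → Set
  Bicolored k κ = rungColor κ (succ k) ≡ rungColor κ k × (∀ s → rimColor κ s k ≡ rimColor κ zero k)

  uniform-bicolored : ∀ a x y q k → Bicolored k (uniform a x y q)
  uniform-bicolored a x y q k = refl , λ _ → refl

  -- A Kempe change on the 4-cycle through the rungs k and succ k.
  swapSquare : Fin m → PrismColoring → PrismColoring
  swapSquare k κ = coloring
    (updateAt (updateAt (rungColor κ) k (const (rimColor κ zero k))) (succ k) (const (rimColor κ zero k)))
    (λ s → updateAt (rimColor κ s) k (const (rungColor κ k)))

  module _ (k : Fin m) (κ : PrismColoring) where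

    swapSquare-rung-inside : ∀ {i} → i ≡ k ⊎ i ≡ succ k → rungColor (swapSquare k κ) i ≡ rimColor κ zero k
    swapSquare-rung-inside (inj₁ refl) =
      trans (updateAt-minimal k (succ k) _ (≢-sym (succ≢id k))) (updateAt-updates k (rungColor κ))
    swapSquare-rung-inside (inj₂ refl) = updateAt-updates (succ k) _

    swapSquare-rung-outside : ∀ {i} → i ≢ k → i ≢ succ k → rungColor (swapSquare k κ) i ≡ rungColor κ i
    swapSquare-rung-outside {i} i≢k i≢sk =
      trans (updateAt-minimal i (succ k) _ i≢sk) (updateAt-minimal i k (rungColor κ) i≢k)

    swapSquare-rim-inside : ∀ s → rimColor (swapSquare k κ) s k ≡ rungColor κ k
    swapSquare-rim-inside s = updateAt-updates k (rimColor κ s)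

    swapSquare-rim-outside : ∀ s {l} → l ≢ k → rimColor (swapSquare k κ) s l ≡ rimColor κ s l
    swapSquare-rim-outside s {l} l≢k = updateAt-minimal l k (rimColor κ s) l≢k

  swapSquare-proper : ∀ {κ} k → LocallyProper κ → Bicolored k κ → LocallyProper (swapSquare k κ)
  swapSquare-proper {κ} k lp (rung-eq , rim-eq) s p with p ≟ k | succ p ≟ k
  ... | yes refl | _ =
    Distinct₃-resp (swapSquare-rung-inside k κ (inj₂ refl))
                   (swapSquare-rim-outside k κ s (succ≢id k))
                   (swapSquare-rim-inside k κ s)
      ( (λ e → proj₂ (proj₂ (lp s k)) (trans (sym e) (sym (rim-eq s))))
      , ≢-sym (rung≢rim-forward {κ} lp zero k)
      , (λ e → proj₁ (lp s k) (trans rung-eq (sym e))) )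
  ... | no p≢k | yes refl =
    Distinct₃-resp (swapSquare-rung-inside k κ (inj₁ refl))
                   (swapSquare-rim-inside k κ s)
                   (swapSquare-rim-outside k κ s p≢k)
      ( ≢-sym (rung≢rim-forward {κ} lp zero (succ p))
      , (λ e → proj₂ (proj₂ (lp s p)) (trans (rim-eq s) e))
      , proj₁ (proj₂ (lp s p)) )
  ... | no p≢k | no sp≢k =
    Distinct₃-resp (swapSquare-rung-outside k κ sp≢k (p≢k ∘ succ-injective))
                   (swapSquare-rim-outside k κ s sp≢k)
                   (swapSquare-rim-outside k κ s p≢k)
      (lp s p)

  swapSquare-bicolored : ∀ {κ} k l → Bicolored l κ →
    l ≢ k → l ≢ succ k → succ l ≢ k → succ l ≢ succ k → Bicolored l (swapSquare k κ)
  swapSquare-bicolored {κ} k l (rung-eq , rim-eq) l≢k l≢sk sl≢k sl≢sk =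
      trans (swapSquare-rung-outside k κ sl≢k sl≢sk)
            (trans rung-eq (sym (swapSquare-rung-outside k κ l≢k l≢sk)))
    , λ s → trans (swapSquare-rim-outside k κ s l≢k)
                  (trans (rim-eq s) (sym (swapSquare-rim-outside k κ zero l≢k)))

  uniform-swap-proper : ∀ {a x y} → Distinct₃ a x y → ∀ q k → LocallyProper (swapSquare k (uniform a x y q))
  uniform-swap-proper d q k = swapSquare-proper k (alternating-proper d (const q)) (uniform-bicolored _ _ _ q k)

  separatingSquare : ∀ i j → i ≢ j → Σ (Fin m) λ k → (i ≡ k ⊎ i ≡ succ k) × j ≢ k × j ≢ succ k
  separatingSquare i j i≢j with succ i ≟ j
  ... | no si≢j = i , inj₁ refl , ≢-sym i≢j , ≢-sym si≢j
  ... | yes refl =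
    pred i , inj₂ (sym (succ-pred i)) ,
    (λ e → succ²≢id i (trans (cong succ e) (succ-pred i))) ,
    (λ e → i≢j (sym (trans e (succ-pred i))))

  data Edge : Set where
    rung : Fin m → Edge
    rim  : Fin 2 → Fin m → Edge

  colorOf : PrismColoring → Edge → Color
  colorOf κ (rung i)  = rungColor κ i
  colorOf κ (rim s k) = rimColor κ s k

  Incident : Edge → Vtx m → Set
  Incident (rung i)  (j , t) = j ≡ i
  Incident (rim s k) (j , t) = t ≡ s × (j ≡ k ⊎ j ≡ succ k)

  Compatible : Edge → Color → Edge → Color → Set
  Compatible e₁ c₁ e₂ c₂ = ∀ v → Incident e₁ v → Incident e₂ v → c₁ ≢ c₂

  Extension : Edge → Color → Edge → Color → Set
  Extension e₁ c₁ e₂ c₂ = Σ PrismColoring λ κ → LocallyProper κ × colorOf κ e₁ ≡ c₁ × colorOf κ e₂ ≡ c₂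

  extend-rungs : ∀ i j c₁ c₂ → i ≢ j → Extension (rung i) c₁ (rung j) c₂
  extend-rungs i j c₁ c₂ i≢j with c₁ ≟ c₂
  ... | yes refl =
    uniform c₁ (next c₁) (third c₁ (next c₁)) 0ℙ ,
    alternating-proper (next-third-distinct c₁) (const 0ℙ) , refl , refl
  ... | no c₁≢c₂ with separatingSquare i j i≢j
  ...   | k , i∈k , j≢k , j≢sk =
    swapSquare k κ ,
    uniform-swap-proper (third-distinct c₂ c₁ (≢-sym c₁≢c₂)) (side k) k ,
    trans (swapSquare-rung-inside k κ i∈k) (alternate-p+p (side k) c₁ _) ,
    swapSquare-rung-outside k κ j≢k j≢sk
    where
    κ = uniform c₂ c₁ (third c₂ c₁) (side k)

  extend-rung-rim : ∀ i s k c₁ c₂ → Compatible (rung i) c₁ (rim s k) c₂ → Extension (rung i) c₁ (rim s k) c₂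
  extend-rung-rim i s k c₁ c₂ compatible with c₁ ≟ c₂
  ... | no c₁≢c₂ =
    uniform c₁ c₂ (third c₁ c₂) (side k) ,
    alternating-proper (third-distinct c₁ c₂ c₁≢c₂) (const (side k)) , refl , alternate-p+p (side k) c₂ _
  ... | yes refl =
    swapSquare k κ ,
    uniform-swap-proper (next-third-distinct c₁) 0ℙ k ,
    swapSquare-rung-outside k κ (λ e → compatible (i , s) refl (refl , inj₁ e) refl)
                                (λ e → compatible (i , s) refl (refl , inj₂ e) refl) ,
    swapSquare-rim-inside k κ s
    where
    κ = uniform c₁ (next c₁) (third c₁ (next c₁)) 0ℙ

  extend-different-rims : ∀ s k s′ l c₁ c₂ → s ≢ s′ → Extension (rim s k) c₁ (rim s′ l) c₂
  extend-different-rims s k s′ l c₁ c₂ s≢s′ with c₁ ≟ c₂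
  ... | no c₁≢c₂ =
    alternating (third c₁ c₂) c₁ c₂ phase ,
    alternating-proper (Distinct₃-rotate (third-distinct c₁ c₂ c₁≢c₂)) phase ,
    trans (alternating-rim (third c₁ c₂) c₁ c₂ phase s k (updateAt-updates s (const (side l ⁻¹)))) (alternate-p+p (side k) c₁ c₂) ,
    trans (alternating-rim (third c₁ c₂) c₁ c₂ phase s′ l (updateAt-minimal s′ s _ (≢-sym s≢s′)))
          (alternate-p⁻¹+p (side l) c₁ c₂)
    where
    phase = updateAt (const (side l ⁻¹)) s (const (side k))
  ... | yes refl =
    alternating (third c₁ (next c₁)) c₁ (next c₁) phase ,
    alternating-proper (Distinct₃-rotate (next-third-distinct c₁)) phase ,
    trans (alternating-rim (third c₁ (next c₁)) c₁ (next c₁) phase s k (updateAt-updates s (const (side l)))) (alternate-p+p (side k) c₁ _) ,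
    trans (alternating-rim (third c₁ (next c₁)) c₁ (next c₁) phase s′ l (updateAt-minimal s′ s _ (≢-sym s≢s′)))
          (alternate-p+p (side l) c₁ _)
    where
    phase = updateAt (const (side l)) s (const (side k))

  extend-same-rim : ∀ s k l c₁ c₂ → k ≢ l → Compatible (rim s k) c₁ (rim s l) c₂ →
    Extension (rim s k) c₁ (rim s l) c₂
  extend-same-rim s k l c₁ c₂ k≢l compatible with c₁ ≟ c₂
  ... | no c₁≢c₂ =
    swapSquare k κ ,
    uniform-swap-proper (third-distinct c₁ c₂ c₁≢c₂) (side l) k ,
    swapSquare-rim-inside k κ s ,
    trans (swapSquare-rim-outside k κ s (≢-sym k≢l)) (alternate-p+p (side l) c₂ _)
    where
    κ = uniform c₁ c₂ (third c₁ c₂) (side l)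
  ... | yes refl =
    swapSquare l κ′ ,
    swapSquare-proper l (uniform-swap-proper (next-third-distinct c₁) 0ℙ k)
      (swapSquare-bicolored k l (uniform-bicolored _ _ _ 0ℙ l) l≢k l≢sk sl≢k (l≢k ∘ succ-injective)) ,
    trans (swapSquare-rim-outside l κ′ s k≢l) (swapSquare-rim-inside k κ s) ,
    trans (swapSquare-rim-inside l κ′ s) (swapSquare-rung-outside k κ l≢k l≢sk)
    where
    κ = uniform c₁ (next c₁) (third c₁ (next c₁)) 0ℙ
    κ′ = swapSquare k κ
    l≢k : l ≢ k
    l≢k = ≢-sym k≢l
    l≢sk : l ≢ succ k
    l≢sk e = compatible (succ k , s) (refl , inj₂ refl) (refl , inj₁ (sym e)) refl
    sl≢k : succ l ≢ k
    sl≢k e = compatible (k , s) (refl , inj₁ refl) (refl , inj₂ (sym e)) refl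

  extend : ∀ e₁ c₁ e₂ c₂ → e₁ ≢ e₂ → Compatible e₁ c₁ e₂ c₂ → Extension e₁ c₁ e₂ c₂
  extend (rung i) c₁ (rung j) c₂ e₁≢e₂ _ = extend-rungs i j c₁ c₂ (e₁≢e₂ ∘ cong rung)
  extend (rung i) c₁ (rim s k) c₂ _ compatible = extend-rung-rim i s k c₁ c₂ compatible
  extend (rim s k) c₁ (rung i) c₂ _ compatible
    with extend-rung-rim i s k c₂ c₁ (λ v inc₁ inc₂ e → compatible v inc₂ inc₁ (sym e))
  ... | κ , lp , eq₁ , eq₂ = κ , lp , eq₂ , eq₁
  extend (rim s k) c₁ (rim s′ l) c₂ e₁≢e₂ compatible with s ≟ s′
  ... | no s≢s′ = extend-different-rims s k s′ l c₁ c₂ s≢s′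
  ... | yes refl = extend-same-rim s k l c₁ c₂ (e₁≢e₂ ∘ cong (rim s)) compatible

  data Step : Vtx m → Vtx m → Set where
    across   : ∀ {i s t} → s ≢ t → Step (i , s) (i , t)
    forward  : ∀ {i j s} → succ i ≡ j → Step (i , s) (j , s)
    backward : ∀ {i j s} → succ j ≡ i → Step (i , s) (j , s)

  step : ∀ {u v} → Adj m u v → Step u v
  step (inj₁ (inj₁ c , refl)) = forward (CSucc⇒succ c)
  step (inj₁ (inj₂ c , refl)) = backward (CSucc⇒succ c)
  step (inj₂ (refl , s≢t))    = across s≢t

  reverse : ∀ {u v} → Step u v → Step v u
  reverse (across s≢t) = across (≢-sym s≢t)
  reverse (forward e)  = backward e
  reverse (backward e) = forward e

  edgeOf : ∀ {u v} → Step u v → Edge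
  edgeOf (across {i} _)            = rung i
  edgeOf (forward {i} {s = s} _)   = rim s i
  edgeOf (backward {j = j} {s} _)  = rim s j

  edgeOf-reverse : ∀ {u v} (st : Step u v) → edgeOf (reverse st) ≡ edgeOf st
  edgeOf-reverse (across _)   = refl
  edgeOf-reverse (forward _)  = refl
  edgeOf-reverse (backward _) = refl

  step-≢ : ∀ {u v} → Step u v → u ≢ v
  step-≢ (across s≢t)           e = s≢t (cong proj₂ e)
  step-≢ (forward {i} succi≡j)  e = succ≢id i (trans succi≡j (sym (cong proj₁ e)))
  step-≢ (backward {j = j} succj≡i) e = succ≢id j (trans succj≡i (cong proj₁ e))

  step-source : ∀ {u v} (st : Step u v) → Incident (edgeOf st) u
  step-source (across _)   = refl
  step-source (forward _)  = refl , inj₁ refl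
  step-source (backward e) = refl , inj₂ (sym e)

  step-target : ∀ {u v} (st : Step u v) → Incident (edgeOf st) v
  step-target (across _)   = refl
  step-target (forward e)  = refl , inj₂ (sym e)
  step-target (backward _) = refl , inj₁ refl

  step-endpoints : ∀ {u v} (st : Step u v) w → Incident (edgeOf st) w → w ≡ u ⊎ w ≡ v
  step-endpoints (across {i} {s} s≢t) (_ , r) refl with r ≟ s
  ... | yes refl = inj₁ refl
  ... | no r≢s   = inj₂ (cong (i ,_) (≢-unique (≢-sym r≢s) s≢t))
  step-endpoints (forward _)  _ (refl , inj₁ refl) = inj₁ refl
  step-endpoints (forward e)  _ (refl , inj₂ refl) = inj₂ (cong (_, _) e)
  step-endpoints (backward e) _ (refl , inj₂ refl) = inj₁ (cong (_, _) e)
  step-endpoints (backward _) _ (refl , inj₁ refl) = inj₂ refl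

  step-sameEdge : ∀ {a₁ b₁ a₂ b₂} (st₁ : Step a₁ b₁) (st₂ : Step a₂ b₂) →
    edgeOf st₁ ≡ edgeOf st₂ → SameEdge a₁ b₁ a₂ b₂
  step-sameEdge st₁ st₂ eq
    with step-endpoints st₂ _ (subst (λ e → Incident e _) eq (step-source st₁))
       | step-endpoints st₂ _ (subst (λ e → Incident e _) eq (step-target st₁))
  ... | inj₁ p | inj₁ q = ⊥-elim (step-≢ st₁ (trans p (sym q)))
  ... | inj₁ p | inj₂ q = inj₁ (p , q)
  ... | inj₂ p | inj₁ q = inj₂ (p , q)
  ... | inj₂ p | inj₂ q = ⊥-elim (step-≢ st₁ (trans p (sym q)))

  colorBetween : PrismColoring → Vtx m → Vtx m → Color
  colorBetween κ (i , s) (j , _) with i ≟ j | succ i ≟ j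
  ... | yes _ | _     = rungColor κ i
  ... | no _  | yes _ = rimColor κ s i
  ... | no _  | no _  = rimColor κ s j

  colorBetween-step : ∀ κ {u v} (st : Step u v) → colorBetween κ u v ≡ colorOf κ (edgeOf st)
  colorBetween-step κ (across {i} _) with i ≟ i
  ... | yes _  = refl
  ... | no i≢i = ⊥-elim (i≢i refl)
  colorBetween-step κ (forward {i} refl) with i ≟ succ i | succ i ≟ succ i
  ... | yes e | _       = ⊥-elim (succ≢id i (sym e))
  ... | no _  | yes _   = refl
  ... | no _  | no ne   = ⊥-elim (ne refl)
  colorBetween-step κ (backward {j = j} refl) with succ j ≟ j | succ (succ j) ≟ j
  ... | yes e | _       = ⊥-elim (succ≢id j e)
  ... | no _  | yes e   = ⊥-elim (succ²≢id j e)
  ... | no _  | no _    = refl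

  colorBetween-sym : ∀ κ {u v} → Step u v → colorBetween κ u v ≡ colorBetween κ v u
  colorBetween-sym κ st =
    trans (colorBetween-step κ st)
          (sym (trans (colorBetween-step κ (reverse st)) (cong (colorOf κ) (edgeOf-reverse st))))

  step-colors-distinct : ∀ {κ u v w} → LocallyProper κ → (st : Step u v) (st′ : Step u w) → v ≢ w →
    colorOf κ (edgeOf st) ≢ colorOf κ (edgeOf st′)
  step-colors-distinct {κ} lp (across s≢t) (across s≢t′) v≢w _ = v≢w (cong (_ ,_) (≢-unique s≢t s≢t′))
  step-colors-distinct {κ} lp (across _)   (forward _)   _ = rung≢rim-forward {κ} lp _ _
  step-colors-distinct {κ} lp (across _)   (backward e)  _ = rung≢rim-backward {κ} lp _ e
  step-colors-distinct {κ} lp (forward _)  (across _)    _ = ≢-sym (rung≢rim-forward {κ} lp _ _)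
  step-colors-distinct {κ} lp (forward e)  (forward e′) v≢w _ = v≢w (cong (_, _) (trans (sym e) e′))
  step-colors-distinct {κ} lp (forward _)  (backward e)  _ = rim-forward≢backward {κ} lp _ e
  step-colors-distinct {κ} lp (backward e) (across _)    _ = ≢-sym (rung≢rim-backward {κ} lp _ e)
  step-colors-distinct {κ} lp (backward e) (forward _)   _ = ≢-sym (rim-forward≢backward {κ} lp _ e)
  step-colors-distinct {κ} lp (backward e) (backward e′) v≢w _ =
    v≢w (cong (_, _) (succ-injective (trans e (sym e′))))

  toEdgeColoring : PrismColoring → EdgeColoring m 3
  toEdgeColoring κ = record
    { col        = λ u v _ → colorBetween κ u v
    ; undirected = λ u v a _ → colorBetween-sym κ (step a)
    ; irrelevant = λ _ _ _ _ → refl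
    }

  toEdgeColoring-proper : ∀ {κ} → LocallyProper κ → Proper (toEdgeColoring κ)
  toEdgeColoring-proper {κ} lp u v w a b v≢w same =
    step-colors-distinct {κ} lp (step a) (step b) v≢w
      (trans (sym (colorBetween-step κ (step a))) (trans same (colorBetween-step κ (step b))))

  extendPrecoloring : (φ : TwoEdgePrecoloring m) → Σ (EdgeColoring m 3) λ f → Proper f × Extends f φ
  extendPrecoloring φ = finish (extend (edgeOf st₁) c₁ (edgeOf st₂) c₂ edges-≢ compatible)
    where
    open TwoEdgePrecoloring φ
    st₁ = step e₁
    st₂ = step e₂
    edges-≢ : edgeOf st₁ ≢ edgeOf st₂
    edges-≢ eq = distinct (step-sameEdge st₁ st₂ eq)
    compatible : Compatible (edgeOf st₁) c₁ (edgeOf st₂) c₂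
    compatible v inc₁ inc₂ = proper (shared-endpoint (step-endpoints st₁ v inc₁) (step-endpoints st₂ v inc₂))
    finish : Extension (edgeOf st₁) c₁ (edgeOf st₂) c₂ → Σ (EdgeColoring m 3) λ f → Proper f × Extends f φ
    finish (κ , lp , eq₁ , eq₂) =
      toEdgeColoring κ , toEdgeColoring-proper lp ,
      trans (colorBetween-step κ st₁) eq₁ , trans (colorBetween-step κ st₂) eq₂

CSucc-functional : ∀ {m} {i j j′ : Fin m} → CSucc m i j → CSucc m i j′ → j ≡ j′
CSucc-functional         (inj₁ e)       (inj₁ e′)       = toℕ-injective (trans (sym e) e′)
CSucc-functional {j = j} (inj₁ e)       (inj₂ (w , _))  = ⊥-elim (<-irrefl (trans (sym e) w) (toℕ<n j))
CSucc-functional {j′ = j′} (inj₂ (w , _)) (inj₁ e′)     = ⊥-elim (<-irrefl (trans (sym e′) w) (toℕ<n j′))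
CSucc-functional         (inj₂ (_ , z)) (inj₂ (_ , z′)) = toℕ-injective (trans z (sym z′))

CSucc-injective : ∀ {m} {i j k : Fin m} → CSucc m i k → CSucc m j k → i ≡ j
CSucc-injective (inj₁ e)       (inj₁ e′)       = toℕ-injective (suc-injective (trans e (sym e′)))
CSucc-injective (inj₁ e)       (inj₂ (_ , z′)) = ⊥-elim (1+n≢0 (trans e z′))
CSucc-injective (inj₂ (_ , z)) (inj₁ e′)       = ⊥-elim (1+n≢0 (trans e′ z))
CSucc-injective (inj₂ (w , _)) (inj₂ (w′ , _)) = toℕ-injective (suc-injective (trans w (sym w′)))

CSucc-no-2-cycle : ∀ {m} {i j : Fin m} → 3 ≤ m → CSucc m i j → CSucc m j i → ⊥
CSucc-no-2-cycle {i = i} _ (inj₁ e) (inj₁ e′) = m≢1+n+m (toℕ i) {1} (sym (trans (cong suc e) e′))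
CSucc-no-2-cycle (s≤s (s≤s (s≤s _))) (inj₁ e) (inj₂ (w , z)) =
  1+n≢0 (suc-injective (suc-injective (trans (sym w) (cong suc (trans (sym e) (cong suc z))))))
CSucc-no-2-cycle (s≤s (s≤s (s≤s _))) (inj₂ (w , z)) (inj₁ e) =
  1+n≢0 (suc-injective (suc-injective (trans (sym w) (cong suc (trans (sym e) (cong suc z))))))
CSucc-no-2-cycle (s≤s (s≤s (s≤s _))) (inj₂ (w , _)) (inj₂ (_ , z′)) =
  1+n≢0 (suc-injective (trans (sym w) (cong suc z′)))

CSucc-parity : ∀ {m} {i j : Fin m} → parity m ≡ 0ℙ → CSucc m i j → parity (toℕ j) ≡ parity (toℕ i) ⁻¹
CSucc-parity {i = i} _ (inj₁ e) =
  trans (cong parity (sym e)) (sym (⁻¹-selfInverse (suc-homo-⁻¹ (toℕ i))))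
CSucc-parity {i = i} even (inj₂ (w , z)) =
  trans (cong parity z) (sym (trans (⁻¹-selfInverse (suc-homo-⁻¹ (toℕ i))) (trans (cong parity w) even)))

cyclicSucc : ∀ {m} → Fin (suc m) → Fin (suc m)
cyclicSucc {m} i with suc (toℕ i) <? suc m
... | yes i+1<m = fromℕ< i+1<m
... | no _      = zero

cyclicSucc-CSucc : ∀ {m} (i : Fin (suc m)) → CSucc (suc m) i (cyclicSucc i)
cyclicSucc-CSucc {m} i with suc (toℕ i) <? suc m
... | yes i+1<m = inj₁ (sym (toℕ-fromℕ< i+1<m))
... | no i+1≮m  = inj₂ (≤-antisym (toℕ<n i) (≮⇒≥ i+1≮m) , refl)

cyclicPred : ∀ {m} → Fin (suc m) → Fin (suc m)
cyclicPred {m} zero = fromℕ m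
cyclicPred (suc i)  = inject₁ i

cyclicPred-CSucc : ∀ {m} (i : Fin (suc m)) → CSucc (suc m) (cyclicPred i) i
cyclicPred-CSucc {m} zero = inj₂ (cong suc (toℕ-fromℕ m) , refl)
cyclicPred-CSucc (suc i)  = inj₁ (cong suc (toℕ-inject₁ i))

evenCycle : ∀ {m} → 3 ≤ m → parity m ≡ 0ℙ → EvenCycle m
evenCycle {suc m} 3≤m even = record
  { succ           = cyclicSucc
  ; pred           = cyclicPred
  ; succ-pred      = λ i → CSucc-functional (cyclicSucc-CSucc (cyclicPred i)) (cyclicPred-CSucc i)
  ; succ-injective = λ {i} {j} e →
      CSucc-injective (cyclicSucc-CSucc i) (subst (CSucc _ j) (sym e) (cyclicSucc-CSucc j))
  ; succ²≢id       = λ i e →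
      CSucc-no-2-cycle 3≤m (cyclicSucc-CSucc i) (subst (CSucc _ (cyclicSucc i)) e (cyclicSucc-CSucc (cyclicSucc i)))
  ; side           = parity ∘ toℕ
  ; side-succ      = λ i → CSucc-parity even (cyclicSucc-CSucc i)
  ; CSucc⇒succ     = CSucc-functional (cyclicSucc-CSucc _)
  }

proposition4p3 : (n : ℕ) → 2 ≤ n → (φ : TwoEdgePrecoloring (2 * n)) →
    Σ (EdgeColoring (2 * n) 3) (λ f → Proper f × Extends f φ)
proposition4p3 n 2≤n = Prism.extendPrecoloring (evenCycle 3≤2n (*-homo-* 2 n))
  where
  3≤2n : 3 ≤ 2 * n
  3≤2n = ≤-trans (n≤1+n 3) (*-monoʳ-≤ 2 2≤n)
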